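{- $(P^*,\tau)$ is irreducible: for all $t,t'\in P^*$ there exists $k\in\mathbb{N}$ such that $t'$ appears in $\tau^k(t)$.
   Context: Let $p$ be an odd prime and $\mathbb{F}_p$ the field with $p$ elements. A (one-dimensional) tile $\square(x,y)$ is a unit segment whose left and right endpoints are decorated with $x,y\in\mathbb{F}_p$. $P$ is the set of all such tiles and $P^*=P\setminus\{\square(0,0)\}$. The substitution $\tau$ maps $\square(x,y)$ to the sequence of two tiles $\square(x,x+y)\,\square(x+y,y)$ (inflation by $2$); it acts on finite sequences of tiles by concatenating images. A tile $t'$ appears in $\tau^k(t)$ if it is one of the $2^k$ tiles of the sequence $\tau^k(t)$. -}

module Defs where

open import Data.Nat using (ℕ; zero; suc; NonZero) renaming (_+_ to _+ℕ_)
open import Data.Nat.DivMod using (_%_; m%n<n)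
open import Data.Fin using (Fin; toℕ; fromℕ<)
open import Data.Product using (_×_; _,_)
open import Data.List using (List; []; _∷_; _++_; concatMap)

_⊕_ : ∀ {p} .{{_ : NonZero p}} → Fin p → Fin p → Fin p
_⊕_ {p} x y = fromℕ< (m%n<n (toℕ x +ℕ toℕ y) p)

-- a tile □(x,y): left decoration x, right decoration y
Tile : ℕ → Set
Tile p = Fin p × Fin p

τ₁ : ∀ {p} .{{_ : NonZero p}} → Tile p → List (Tile p)
τ₁ (x , y) = (x , x ⊕ y) ∷ (x ⊕ y , y) ∷ []

τ : ∀ {p} .{{_ : NonZero p}} → List (Tile p) → List (Tile p)
τ = concatMap τ₁

τ^ : ∀ {p} .{{_ : NonZero p}} → ℕ → List (Tile p) → List (Tile p)
τ^ zero ts = ts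
τ^ (suc k) ts = τ (τ^ k ts)

0F : ∀ {p} .{{_ : NonZero p}} → Fin p
0F {p} = fromℕ< (m%n<n 0 p)

-- the excluded tile □(0,0)
□00 : ∀ {p} .{{_ : NonZero p}} → Tile p
□00 = 0F , 0F

module Submission where

-- τ(□(x,y)) consists of □(x,x+y) and □(x+y,y), so from □(x,y) one reaches
-- □(x,y+nx) and □(x+ny,y) for every n. Over a prime field a nonzero decoration is
-- invertible, so fixing a nonzero end lets the other end run through all of 𝔽_p.
-- Alternating the two moves connects every tile of P* to the hub □(1,1) and back,
-- and appearance is transitive because τ^k distributes over concatenation.

open import Defs
open import Data.Nat using (ℕ; NonZero; zero; suc; _+_; _*_; _∸_)
open import Data.Nat.Properties using (+-comm; +-identityʳ; *-identityʳ; m+[n∸m]≡n; <⇒≤)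
open import Data.Nat.DivMod using (_%_; m%n<n; %-distribˡ-+; %-distribˡ-*; m%n%n≡m%n; [m+n]%n≡m%n; [m+kn]%n≡m%n; m<n⇒m%n≡m)
open import Data.Nat.Primality using (Prime; ¬prime[1])
open import Data.Nat.Coprimality using (Coprime; coprime-Bézout; prime⇒coprime) renaming (sym to coprime-sym)
open import Data.Nat.GCD using (module Bézout)
open import Data.Nat.Solver using (module +-*-Solver)
open import Data.Fin using (Fin; toℕ; fromℕ<) renaming (zero to fz; suc to fs)
open import Data.Fin.Properties using (toℕ-injective; toℕ-fromℕ<; toℕ<n)
open import Data.Product using (_,_; ∃-syntax)
open import Data.List using (List; _∷_; []; _++_)
open import Data.List.Properties using (++-assoc)
open import Data.List.Membership.Propositional using (_∈_)
open import Data.List.Membership.Propositional.Properties using (∈-++⁺ˡ; ∈-++⁺ʳ)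
open import Data.List.Relation.Unary.Any using (here; there)
open import Data.Empty using (⊥-elim)
open import Relation.Binary.PropositionalEquality
open import Relation.Nullary using (¬_)
open +-*-Solver

module _ {p : ℕ} .{{_ : NonZero p}} where

  τ-++ : (xs ys : List (Tile p)) → τ (xs ++ ys) ≡ τ xs ++ τ ys
  τ-++ []       ys = refl
  τ-++ (x ∷ xs) ys = trans (cong (τ₁ x ++_) (τ-++ xs ys)) (sym (++-assoc (τ₁ x) (τ xs) (τ ys)))

  τ^-++ : ∀ k (xs ys : List (Tile p)) → τ^ k (xs ++ ys) ≡ τ^ k xs ++ τ^ k ys
  τ^-++ zero    xs ys = refl
  τ^-++ (suc k) xs ys = trans (cong τ (τ^-++ k xs ys)) (τ-++ (τ^ k xs) (τ^ k ys))

  τ^-+ : ∀ m n (ts : List (Tile p)) → τ^ (m + n) ts ≡ τ^ m (τ^ n ts)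
  τ^-+ zero    n ts = refl
  τ^-+ (suc m) n ts = cong τ (τ^-+ m n ts)

  ∈-τ^-∈ : ∀ k {t t′ : Tile p} {ts} → t′ ∈ τ^ k (t ∷ []) → t ∈ ts → t′ ∈ τ^ k ts
  ∈-τ^-∈ k {ts = u ∷ us} t′∈ (here refl) rewrite τ^-++ k (u ∷ []) us = ∈-++⁺ˡ t′∈
  ∈-τ^-∈ k {ts = u ∷ us} t′∈ (there t∈) rewrite τ^-++ k (u ∷ []) us =
    ∈-++⁺ʳ (τ^ k (u ∷ [])) (∈-τ^-∈ k t′∈ t∈)

  infix 4 _↝_
  _↝_ : Tile p → Tile p → Set
  t ↝ t′ = ∃[ k ] t′ ∈ τ^ k (t ∷ [])

  ↝-refl : ∀ {t} → t ↝ t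
  ↝-refl = 0 , here refl

  ↝-trans : ∀ {t t′ t″} → t ↝ t′ → t′ ↝ t″ → t ↝ t″
  ↝-trans {t} (m , t′∈) (n , t″∈) =
    n + m , subst (_ ∈_) (sym (τ^-+ n m (t ∷ []))) (∈-τ^-∈ n t″∈ t′∈)

  ⊕-comm : (x y : Fin p) → x ⊕ y ≡ y ⊕ x
  ⊕-comm x y = cong (λ m → fromℕ< (m%n<n m p)) (+-comm (toℕ x) (toℕ y))

  +-%-congʳ : ∀ a {b c} → b % p ≡ c % p → (a + b) % p ≡ (a + c) % p
  +-%-congʳ a {b} {c} b≡c = begin
    (a + b) % p             ≡⟨ %-distribˡ-+ a b p ⟩
    (a % p + b % p) % p     ≡⟨ cong (λ w → (a % p + w) % p) b≡c ⟩
    (a % p + c % p) % p     ≡⟨ %-distribˡ-+ a c p ⟨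
    (a + c) % p             ∎
    where open ≡-Reasoning

  shift : Fin p → ℕ → Fin p → Fin p
  shift x zero    y = y
  shift x (suc n) y = x ⊕ shift x n y

  toℕ-shift : ∀ x n y → toℕ (shift x n y) ≡ (toℕ y + n * toℕ x) % p
  toℕ-shift x zero y = sym (trans (cong (_% p) (+-identityʳ (toℕ y))) (m<n⇒m%n≡m (toℕ<n y)))
  toℕ-shift x (suc n) y = begin
    toℕ (x ⊕ shift x n y)                  ≡⟨ toℕ-fromℕ< (m%n<n (X + toℕ (shift x n y)) p) ⟩
    (X + toℕ (shift x n y)) % p            ≡⟨ +-%-congʳ X (trans (cong (_% p) (toℕ-shift x n y)) (m%n%n≡m%n _ p)) ⟩
    (X + (toℕ y + n * X)) % p              ≡⟨ cong (_% p) (solve 3 (λ x y m → x :+ (y :+ m) := y :+ (x :+ m)) refl X (toℕ y) (n * X)) ⟩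
    (toℕ y + suc n * X) % p                ∎
    where
    open ≡-Reasoning
    X = toℕ x

  ↝-shiftʳ : ∀ x n y → (x , y) ↝ (x , shift x n y)
  ↝-shiftʳ x zero    y = ↝-refl
  ↝-shiftʳ x (suc n) y = ↝-trans (↝-shiftʳ x n y) (1 , here refl)

  ↝-shiftˡ : ∀ y n x → (x , y) ↝ (shift y n x , y)
  ↝-shiftˡ y zero    x = ↝-refl
  ↝-shiftˡ y (suc n) x = ↝-trans (↝-shiftˡ y n x) (1 , there (here (cong (_, y) (⊕-comm y _))))

module _ (q : ℕ) where

  private
    P : ℕ
    P = suc (suc q)

  *-inverse-mod : ∀ {x} → Coprime x P → ∃[ i ] (i * x) % P ≡ 1
  *-inverse-mod {x} x⊥P with coprime-Bézout x⊥P
  ... | Bézout.+- a b 1+bP≡ax = a , trans (cong (_% P) (sym 1+bP≡ax)) ([m+kn]%n≡m%n 1 b P)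
  -- here 1 + a·x ≡ b·P, so the inverse is −a = (P − 1)·a
  ... | Bézout.-+ a b 1+ax≡bP = suc q * a , (begin
    (suc q * a * x) % P                ≡⟨ [m+n]%n≡m%n (suc q * a * x) P ⟨
    (suc q * a * x + P) % P            ≡⟨ cong (_% P) (solve 3 (λ q a x → (con 1 :+ q) :* a :* x :+ (con 2 :+ q) := con 1 :+ (con 1 :+ q) :* (con 1 :+ a :* x)) refl q a x) ⟩
    (1 + suc q * (1 + a * x)) % P      ≡⟨ cong (λ w → (1 + suc q * w) % P) 1+ax≡bP ⟩
    (1 + suc q * (b * P)) % P          ≡⟨ cong (λ w → (1 + w) % P) (solve 3 (λ q b n → (con 1 :+ q) :* (b :* n) := (con 1 :+ q) :* b :* n) refl q b P) ⟩
    (1 + suc q * b * P) % P            ≡⟨ [m+kn]%n≡m%n 1 (suc q * b) P ⟩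
    1                                  ∎)
    where open ≡-Reasoning

  module _ (P-prime : Prime P) where

    shift-surjective : (x : Fin P) → ¬ x ≡ fz → ∀ y c → ∃[ n ] shift x n y ≡ c
    shift-surjective fz      x≢0 y c = ⊥-elim (x≢0 refl)
    shift-surjective x@(fs _) _  y c with *-inverse-mod (coprime-sym (prime⇒coprime P-prime (toℕ<n x)))
    ... | i , ix≡1 = i * K , toℕ-injective (begin
      toℕ (shift x (i * K) y)     ≡⟨ toℕ-shift x (i * K) y ⟩
      (Y + i * K * X) % P         ≡⟨ +-%-congʳ Y iKX≡K ⟩
      (Y + K) % P                 ≡⟨ cong (_% P) Y+K≡C+P ⟩
      (C + P) % P                 ≡⟨ [m+n]%n≡m%n C P ⟩
      C % P                       ≡⟨ m<n⇒m%n≡m (toℕ<n c) ⟩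
      C                           ∎)
      where
      open ≡-Reasoning
      X = toℕ x
      Y = toℕ y
      C = toℕ c
      -- K ≡ c − y modulo P, written without truncated subtraction going negative
      K = C + (P ∸ Y)

      iKX≡K : (i * K * X) % P ≡ K % P
      iKX≡K = begin
        (i * K * X) % P                ≡⟨ cong (_% P) (solve 3 (λ i k x → i :* k :* x := k :* (i :* x)) refl i K X) ⟩
        (K * (i * X)) % P              ≡⟨ %-distribˡ-* K (i * X) P ⟩
        (K % P * ((i * X) % P)) % P    ≡⟨ cong (λ w → (K % P * w) % P) ix≡1 ⟩
        (K % P * 1) % P                ≡⟨ cong (_% P) (*-identityʳ (K % P)) ⟩
        K % P % P                      ≡⟨ m%n%n≡m%n K P ⟩
        K % P                          ∎

      Y+K≡C+P : Y + K ≡ C + P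
      Y+K≡C+P = begin
        Y + (C + (P ∸ Y))   ≡⟨ solve 3 (λ y c d → y :+ (c :+ d) := c :+ (y :+ d)) refl Y C (P ∸ Y) ⟩
        C + (Y + (P ∸ Y))   ≡⟨ cong (C +_) (m+[n∸m]≡n (<⇒≤ (toℕ<n y))) ⟩
        C + P               ∎

    ↝-anyʳ : ∀ x → ¬ x ≡ fz → ∀ y c → (x , y) ↝ (x , c)
    ↝-anyʳ x x≢0 y c with shift-surjective x x≢0 y c
    ... | n , refl = ↝-shiftʳ x n y

    ↝-anyˡ : ∀ y → ¬ y ≡ fz → ∀ x c → (x , y) ↝ (c , y)
    ↝-anyˡ y y≢0 x c with shift-surjective y y≢0 x c
    ... | n , refl = ↝-shiftˡ y n x

    private
      one : Fin P
      one = fs fz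

    hub : Tile P
    hub = one , one

    ↝-hub : ∀ t → ¬ t ≡ □00 → t ↝ hub
    ↝-hub (fz   , fz)   t≢0 = ⊥-elim (t≢0 refl)
    ↝-hub (x    , fs y) _   = ↝-trans (↝-anyˡ (fs y) (λ ()) x one) (↝-anyʳ one (λ ()) (fs y) one)
    ↝-hub (fs x , fz)   _   = ↝-trans (↝-anyʳ (fs x) (λ ()) fz one) (↝-anyˡ one (λ ()) (fs x) one)

    hub-↝ : ∀ t → ¬ t ≡ □00 → hub ↝ t
    hub-↝ (fz   , fz)   t≢0 = ⊥-elim (t≢0 refl)
    hub-↝ (x    , fs y) _   = ↝-trans (↝-anyʳ one (λ ()) one (fs y)) (↝-anyˡ (fs y) (λ ()) one x)
    hub-↝ (fs x , fz)   _   = ↝-trans (↝-anyˡ one (λ ()) one (fs x)) (↝-anyʳ (fs x) (λ ()) one fz)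

mainTheorem15 : (p : ℕ) → .{{_ : NonZero p}} → Prime p → ¬ p ≡ 2 →
    (t t′ : Tile p) → ¬ t ≡ □00 → ¬ t′ ≡ □00 →
    ∃[ k ] t′ ∈ τ^ k (t ∷ [])
mainTheorem15 (suc zero)    p-prime _ t t′ t≢0 t′≢0 = ⊥-elim (¬prime[1] p-prime)
mainTheorem15 (suc (suc q)) p-prime _ t t′ t≢0 t′≢0 =
  ↝-trans (↝-hub q p-prime t t≢0) (hub-↝ q p-prime t′ t′≢0)
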